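{- Let $\mathcal R$ be a TRS, let $L$ be a set of labels with binary relations $>$ and $\geqslant$ on $L$, and let $\ell$ be a labeling (with respect to $>$ and $\geqslant$) that is compatible with $\mathcal R$. If every critical peak of $\mathcal R$ is extended locally decreasing for $\ell$, then every local peak of $\mathcal R$ is extended locally decreasing for $\ell$.
   Context: Terms are built from a signature $\mathcal F$ and variables $\mathcal V$. Positions are strings of positive integers; $q\leqslant p$ means $q$ is a prefix of $p$ (then $p\backslash q$ is the remaining suffix), $p\parallel q$ means neither is a prefix of the other. $\mathcal{F}\mathrm{Pos}(t)$ is the set of positions $p$ of $t$ with $t|_p\notin\mathcal V$; $s[t]_p$ is replacement at position $p$. A TRS $\mathcal R$ is a set of rules $l\to r$ (no restriction: $l$ may be a variable and $r$ may contain variables not in $l$). A redex pattern is a triple $\pi=\langle p,l\to r,\sigma\rangle$; a rewrite step $s\to^\pi t$ means $l\to r\in\mathcal R$, $s|_p=l\sigma$ and $t=s[r\sigma]_p$; its inverse is written $t\leftarrow^\pi s$. A conversion is a finite sequence of forward and backward rewrite steps; $\ell$ of a conversion is the set of labels of its steps. A local peak is a pair of steps $t\leftarrow^{\pi_1}s\to^{\pi_2}u$ with $\pi_1=\langle p,l_1\to r_1,\sigma_1\rangle$, $\pi_2=\langle q,l_2\to r_2,\sigma_2\rangle$; it is a parallel peak if $p\parallel q$, a function peak if $q\leqslant p$ and $p\backslash q\in\mathcal{F}\mathrm{Pos}(l_2)$, and a variable peak if $q\leqslant p$ and $p\backslash q\notin\mathcal{F}\mathrm{Pos}(l_2)$.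 A critical overlap $(l_1\to r_1,p,l_2\to r_2)_\mu$ consists of variants of rules of $\mathcal R$ without common variables, a position $p\in\mathcal{F}\mathrm{Pos}(l_2)$ and a most general unifier $\mu$ of $l_1$ and $l_2|_p$ (root overlaps of a rule with a variant of itself are not excluded); it yields the critical peak $l_2\mu[r_1\mu]_p\leftarrow l_2\mu\to r_2\mu$. A labeling is a function $\ell$ from forward and backward rewrite steps to $L$ such that for all contexts $C$ (hole at position $q$) and substitutions $\sigma$: (i) if $\ell(s\to^{\pi_1}t)>\ell(u\to^{\pi_2}v)$ then $\ell(C[s\sigma]\to^{C[\pi_1\sigma]}C[t\sigma])>\ell(C[u\sigma]\to^{C[\pi_2\sigma]}C[v\sigma])$; (ii) the same with $\geqslant$ in place of $>$; (iii) $\ell(s\to^\pi t)=\ell(t\leftarrow^\pi s)$. Here $C[\pi\sigma]=\langle qp,l\to r,\tau\sigma\rangle$ for $\pi=\langle p,l\to r,\tau\rangle$. For $S\subseteq L$ let $\downarrow_> S=\{\gamma\mid \alpha>\gamma\text{ for some }\alpha\in S\}$ and $\downarrow_\geqslant S$ analogously. A local peak $t\leftarrow^{\pi_1}s\to^{\pi_2}u$ with $\alpha=\ell(t\leftarrow^{\pi_1}s)$, $\beta=\ell(s\to^{\pi_2}u)$ is extended locally decreasing for $\ell$ if there are terms $t',t'',u'',u'$ and a local diagram $t\leftrightarrow^*t'\to^=t''\leftrightarrow^*u''\leftarrow^=u'\leftrightarrow^*u$ with $\ell(t\leftrightarrow^*t')\subseteq\downarrow_>\{\alpha\}$, $\ell(t'\to^=t'')\subseteq\downarrow_\geqslant\{\beta\}$,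 $\ell(t''\leftrightarrow^*u'')\subseteq\downarrow_>\{\alpha,\beta\}$, $\ell(u''\leftarrow^=u')\subseteq\downarrow_\geqslant\{\alpha\}$, $\ell(u'\leftrightarrow^*u)\subseteq\downarrow_>\{\beta\}$. A labeling $\ell$ is compatible with $\mathcal R$ if all parallel peaks and all variable peaks of $\mathcal R$ are extended locally decreasing for $\ell$. -}

module Defs where

open import Data.Nat using (ℕ; zero; suc)
open import Data.Vec using (Vec; []; _∷_)
open import Data.List using (List; []; _∷_; _++_)
open import Data.Maybe using (Maybe; just; nothing)
open import Data.Product using (Σ; ∃; _×_; _,_)
open import Data.Sum using (_⊎_)
open import Relation.Nullary using (¬_)
open import Relation.Binary.PropositionalEquality using (_≡_)

-- Signatures, terms (variables are natural numbers: a countably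
-- infinite set V, so that variants with fresh variables always exist)

record Signature : Set₁ where
  field
    Sym   : Set
    arity : Sym → ℕ
open Signature public

Var : Set
Var = ℕ

data Term (S : Signature) : Set where
  var : Var → Term S
  fun : (f : Sym S) → Vec (Term S) (arity S f) → Term S

-- Positions: lists of natural numbers; the entry i stands for the
-- (positive) argument index i+1.  [] is the root position ε.
Pos : Set
Pos = List ℕ

_⩽_ : Pos → Pos → Set
q ⩽ p = ∃ λ r → p ≡ q ++ r

_∥_ : Pos → Pos → Set
p ∥ q = ¬ (p ⩽ q) × ¬ (q ⩽ p)

module _ {S : Signature} where

  Subst : Set
  Subst = Var → Term S

  mutual
    _⟨_⟩ : Term S → Subst → Term S
    var x    ⟨ σ ⟩ = σ x
    fun f ts ⟨ σ ⟩ = fun f (mapSub ts σ)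

    mapSub : ∀ {n} → Vec (Term S) n → Subst → Vec (Term S) n
    mapSub []       σ = []
    mapSub (t ∷ ts) σ = (t ⟨ σ ⟩) ∷ mapSub ts σ

  mutual
    subAt : Term S → Pos → Maybe (Term S)
    subAt t          []      = just t
    subAt (var x)    (i ∷ p) = nothing
    subAt (fun f ts) (i ∷ p) = subAtVec ts i p

    subAtVec : ∀ {n} → Vec (Term S) n → ℕ → Pos → Maybe (Term S)
    subAtVec []       i       p = nothing
    subAtVec (t ∷ ts) zero    p = subAt t p
    subAtVec (t ∷ ts) (suc i) p = subAtVec ts i p

  -- replacement s[u]_p (s unchanged if p ∉ Pos(s); only used for p ∈ Pos(s))
  mutual
    replace : Term S → Pos → Term S → Term S
    replace s          []      u = u
    replace (var x)    (i ∷ p) u = var x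
    replace (fun f ts) (i ∷ p) u = fun f (replaceVec ts i p u)

    replaceVec : ∀ {n} → Vec (Term S) n → ℕ → Pos → Term S → Vec (Term S) n
    replaceVec []       i       p u = []
    replaceVec (t ∷ ts) zero    p u = replace t p u ∷ ts
    replaceVec (t ∷ ts) (suc i) p u = t ∷ replaceVec ts i p u

  mutual
    data Occ (x : Var) : Term S → Set where
      here   : Occ x (var x)
      inside : ∀ {f ts} → OccVec x ts → Occ x (fun f ts)

    data OccVec (x : Var) : ∀ {n} → Vec (Term S) n → Set where
      hd : ∀ {n t} {ts : Vec (Term S) n} → Occ x t → OccVec x (t ∷ ts)
      tl : ∀ {n t} {ts : Vec (Term S) n} → OccVec x ts → OccVec x (t ∷ ts)

  ValidPos : Term S → Pos → Set
  ValidPos t p = ∃ λ u → subAt t p ≡ just u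

  FPos : Term S → Pos → Set
  FPos t p = Σ (Sym S) λ f → Σ (Vec (Term S) (arity S f)) λ ts →
             subAt t p ≡ just (fun f ts)


record Rule (S : Signature) : Set where
  constructor _⇒_
  field
    lhs : Term S
    rhs : Term S
open Rule public

-- A TRS is a set of rules (no restrictions on the rules)
TRS : Signature → Set₁
TRS S = Rule S → Set

record RPat (S : Signature) : Set where
  constructor ⟪_,_,_⟫
  field
    pos  : Pos
    rule : Rule S
    sub  : Subst {S}
open RPat public

module _ {S : Signature} where

  Step : TRS S → Term S → RPat S → Term S → Set
  Step R s π t =
    R (rule π) ×
    subAt s (pos π) ≡ just (lhs (rule π) ⟨ sub π ⟩) ×
    t ≡ replace s (pos π) (rhs (rule π) ⟨ sub π ⟩)

  ctxPat : Pos → RPat S → Subst {S} → RPat S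
  ctxPat q π σ = ⟪ q ++ pos π , rule π , (λ x → sub π x ⟨ σ ⟩) ⟫

data Dir : Set where
  fwd bwd : Dir

-- ℓ fwd s π t : label of the forward step  s →^π t
-- ℓ bwd t π s : label of the backward step t ←^π s
LabFun : Signature → Set → Set
LabFun S L = Dir → Term S → RPat S → Term S → L

module _ {S : Signature} (R : TRS S) {L : Set}
         (_>_ _≥_ : L → L → Set) (ℓ : LabFun S L) where

  SameOnRule : Rule S → Subst {S} → Subst {S} → Set
  SameOnRule ρ σ σ' = ∀ x → Occ x (lhs ρ) ⊎ Occ x (rhs ρ) → σ x ≡ σ' x

  record IsLabeling : Set where
    field
      well-defined : ∀ d s t p ρ σ σ' → SameOnRule ρ σ σ' →
                     ℓ d s ⟪ p , ρ , σ ⟫ t ≡ ℓ d s ⟪ p , ρ , σ' ⟫ t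
      closed-> : ∀ s π₁ t u π₂ v → Step R s π₁ t → Step R u π₂ v →
                 ℓ fwd s π₁ t > ℓ fwd u π₂ v →
                 ∀ (c : Term S) (q : Pos) → ValidPos c q → (σ : Subst {S}) →
                 ℓ fwd (replace c q (s ⟨ σ ⟩)) (ctxPat q π₁ σ) (replace c q (t ⟨ σ ⟩))
                 > ℓ fwd (replace c q (u ⟨ σ ⟩)) (ctxPat q π₂ σ) (replace c q (v ⟨ σ ⟩))
      closed-≥ : ∀ s π₁ t u π₂ v → Step R s π₁ t → Step R u π₂ v →
                 ℓ fwd s π₁ t ≥ ℓ fwd u π₂ v →
                 ∀ (c : Term S) (q : Pos) → ValidPos c q → (σ : Subst {S}) →
                 ℓ fwd (replace c q (s ⟨ σ ⟩)) (ctxPat q π₁ σ) (replace c q (t ⟨ σ ⟩))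
                 ≥ ℓ fwd (replace c q (u ⟨ σ ⟩)) (ctxPat q π₂ σ) (replace c q (v ⟨ σ ⟩))
      symm : ∀ s π t → Step R s π t → ℓ fwd s π t ≡ ℓ bwd t π s

  data Conv (P : L → Set) : Term S → Term S → Set where
    refl-c : ∀ {s} → Conv P s s
    fwd-c  : ∀ {s π u t} → Step R s π u → P (ℓ fwd s π u) → Conv P u t → Conv P s t
    bwd-c  : ∀ {s π u t} → Step R u π s → P (ℓ bwd s π u) → Conv P u t → Conv P s t

  FwdOpt : (L → Set) → Term S → Term S → Set
  FwdOpt P s t = s ≡ t ⊎ Σ (RPat S) λ π → Step R s π t × P (ℓ fwd s π t)

  BwdOpt : (L → Set) → Term S → Term S → Set
  BwdOpt P s t = s ≡ t ⊎ Σ (RPat S) λ π → Step R t π s × P (ℓ bwd s π t)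

  ExtLocDecr : Term S → RPat S → Term S → RPat S → Term S → Set
  ExtLocDecr t π₁ s π₂ u =
    let α = ℓ bwd t π₁ s
        β = ℓ fwd s π₂ u
    in Σ (Term S) λ t' → Σ (Term S) λ t'' → Σ (Term S) λ u'' → Σ (Term S) λ u' →
       Conv (λ γ → α > γ) t t' ×
       FwdOpt (λ γ → β ≥ γ) t' t'' ×
       Conv (λ γ → α > γ ⊎ β > γ) t'' u'' ×
       BwdOpt (λ γ → α ≥ γ) u'' u' ×
       Conv (λ γ → β > γ) u' u

  ParallelPeak : RPat S → RPat S → Set
  ParallelPeak π₁ π₂ = pos π₁ ∥ pos π₂

  VariablePeak : RPat S → RPat S → Set
  VariablePeak π₁ π₂ = Σ Pos λ r → pos π₁ ≡ pos π₂ ++ r × ¬ FPos (lhs (rule π₂)) r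

  Compatible : Set
  Compatible = ∀ s t u π₁ π₂ → Step R s π₁ t → Step R s π₂ u →
               ParallelPeak π₁ π₂ ⊎ VariablePeak π₁ π₂ →
               ExtLocDecr t π₁ s π₂ u

module _ {S : Signature} where

  ren : (Var → Var) → Term S → Term S
  ren θ t = t ⟨ (λ x → var (θ x)) ⟩

  renRule : (Var → Var) → Rule S → Rule S
  renRule θ ρ = ren θ (lhs ρ) ⇒ ren θ (rhs ρ)

  OccRule : Var → Rule S → Set
  OccRule x ρ = Occ x (lhs ρ) ⊎ Occ x (rhs ρ)

  -- critical overlap (l₁ → r₁, p, l₂ → r₂)_μ where lᵢ → rᵢ is the variant
  -- of the rule ρᵢ ∈ R under the variable bijection θᵢ (inverse θᵢ⁻)
  record CriticalOverlap (R : TRS S) : Set where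
    field
      ρ₁ ρ₂   : Rule S
      ρ₁∈R    : R ρ₁
      ρ₂∈R    : R ρ₂
      θ₁ θ₁⁻ θ₂ θ₂⁻ : Var → Var
      θ₁-inv₁ : ∀ x → θ₁⁻ (θ₁ x) ≡ x
      θ₁-inv₂ : ∀ x → θ₁ (θ₁⁻ x) ≡ x
      θ₂-inv₁ : ∀ x → θ₂⁻ (θ₂ x) ≡ x
      θ₂-inv₂ : ∀ x → θ₂ (θ₂⁻ x) ≡ x
      disjoint : ∀ x → OccRule x (renRule θ₁ ρ₁) → ¬ OccRule x (renRule θ₂ ρ₂)
      p       : Pos
      p∈FPos  : FPos (ren θ₂ (lhs ρ₂)) p
      w       : Term S
      w-def   : subAt (ren θ₂ (lhs ρ₂)) p ≡ just w
      μ       : Subst {S}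
      unifies : ren θ₁ (lhs ρ₁) ⟨ μ ⟩ ≡ w ⟨ μ ⟩
      mostGeneral : ∀ (τ : Subst {S}) → ren θ₁ (lhs ρ₁) ⟨ τ ⟩ ≡ w ⟨ τ ⟩ →
                    Σ (Subst {S}) λ δ → ∀ x → τ x ≡ μ x ⟨ δ ⟩

    -- the critical peak  l₂μ[r₁μ]_p ←^π₁ l₂μ →^π₂ r₂μ  (as R-steps: the
    -- variant lᵢ → rᵢ with μ is the rule ρᵢ with substitution μ ∘ θᵢ)
    cpSource : Term S
    cpSource = ren θ₂ (lhs ρ₂) ⟨ μ ⟩

    cpLeft : Term S
    cpLeft = replace cpSource p (ren θ₁ (rhs ρ₁) ⟨ μ ⟩)

    cpRight : Term S
    cpRight = ren θ₂ (rhs ρ₂) ⟨ μ ⟩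

    cpπ₁ : RPat S
    cpπ₁ = ⟪ p , ρ₁ , (λ x → μ (θ₁ x)) ⟫

    cpπ₂ : RPat S
    cpπ₂ = ⟪ [] , ρ₂ , (λ x → μ (θ₂ x)) ⟫

  open CriticalOverlap public

  CriticalPeaksELD : (R : TRS S) {L : Set} (_>_ _≥_ : L → L → Set) (ℓ : LabFun S L) → Set
  CriticalPeaksELD R _>_ _≥_ ℓ = ∀ (co : CriticalOverlap R) →
    ExtLocDecr R _>_ _≥_ ℓ (cpLeft co) (cpπ₁ co) (cpSource co) (cpπ₂ co) (cpRight co)

module Submission where

-- A local peak t ←π₁ s →π₂ u is, up to swapping its two steps, either a
-- parallel peak, a variable peak, or a function peak.  Parallel and variable
-- peaks are extended locally decreasing by compatibility, and swapping the
-- steps of a peak preserves extended local decreasingness (reverse the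
-- diagram).  A function peak at positions q ≤ q·r, with r a function
-- position of the lower rule's left-hand side, is an instance s[ (·)τ ]_q of
-- a critical peak: after renaming the rules apart, the two substitutions
-- combine into one unifier τ of the overlapping terms, hence an mgu μ with
-- τ = μτ exists, and the critical peak of that overlap lifts to the given
-- peak.  Labelings are closed under contexts and substitutions, so the
-- lifted diagram of the critical peak is a diagram for the given peak.

open import Defs
open import Function using (id)
open import Data.Nat using (ℕ; zero; suc; _+_; _∸_; _≤_; _<_; _⊔_; z≤n; s≤s; _≟_; _<?_)
open import Data.Nat.Properties
open import Data.Vec using (Vec; []; _∷_)
open import Data.Vec.Properties using () renaming (∷-injective to vec-∷-injective)
open import Data.List using (List; []; _∷_; _++_)
open import Data.List.Properties using (++-identityʳ) renaming (∷-injective to list-∷-injective)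
open import Data.List.Relation.Unary.All using (All; []; _∷_)
open import Data.Maybe using (just; nothing)
open import Data.Product using (Σ; _×_; _,_; proj₁; proj₂)
open import Data.Sum using (_⊎_; inj₁; inj₂)
open import Data.Empty using (⊥-elim)
open import Relation.Nullary using (¬_; Dec; yes; no)
open import Relation.Binary.PropositionalEquality

just-injective : ∀ {A : Set} {a b : A} → just a ≡ just b → a ≡ b
just-injective refl = refl

module TermAlgebra {S : Signature} where

  _⨾_ : Subst {S} → Subst {S} → Subst {S}
  (σ ⨾ δ) x = σ x ⟨ δ ⟩

  mutual
    subst-comp : ∀ (t : Term S) σ δ → t ⟨ σ ⟩ ⟨ δ ⟩ ≡ t ⟨ σ ⨾ δ ⟩
    subst-comp (var x)    σ δ = refl
    subst-comp (fun f ts) σ δ = cong (fun f) (subst-compᵛ ts σ δ)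

    subst-compᵛ : ∀ {n} (ts : Vec (Term S) n) σ δ → mapSub (mapSub ts σ) δ ≡ mapSub ts (σ ⨾ δ)
    subst-compᵛ []       σ δ = refl
    subst-compᵛ (t ∷ ts) σ δ = cong₂ _∷_ (subst-comp t σ δ) (subst-compᵛ ts σ δ)

  mutual
    subst-cong : ∀ (t : Term S) {σ σ' : Subst} → (∀ x → Occ x t → σ x ≡ σ' x) → t ⟨ σ ⟩ ≡ t ⟨ σ' ⟩
    subst-cong (var x)    h = h x here
    subst-cong (fun f ts) h = cong (fun f) (subst-congᵛ ts (λ x o → h x (inside o)))

    subst-congᵛ : ∀ {n} (ts : Vec (Term S) n) {σ σ' : Subst} →
                  (∀ x → OccVec x ts → σ x ≡ σ' x) → mapSub ts σ ≡ mapSub ts σ'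
    subst-congᵛ []       h = refl
    subst-congᵛ (t ∷ ts) h = cong₂ _∷_ (subst-cong t (λ x o → h x (hd o))) (subst-congᵛ ts (λ x o → h x (tl o)))

  mutual
    subst-id : ∀ (t : Term S) → t ⟨ var ⟩ ≡ t
    subst-id (var x)    = refl
    subst-id (fun f ts) = cong (fun f) (subst-idᵛ ts)

    subst-idᵛ : ∀ {n} (ts : Vec (Term S) n) → mapSub ts var ≡ ts
    subst-idᵛ []       = refl
    subst-idᵛ (t ∷ ts) = cong₂ _∷_ (subst-id t) (subst-idᵛ ts)

  mutual
    occ-subst : ∀ (t : Term S) σ x → Occ x (t ⟨ σ ⟩) → Σ Var λ y → Occ y t × Occ x (σ y)
    occ-subst (var y)    σ x o = y , here , o
    occ-subst (fun f ts) σ x (inside o) with occ-substᵛ ts σ x o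
    ... | y , oy , ox = y , inside oy , ox

    occ-substᵛ : ∀ {n} (ts : Vec (Term S) n) σ x → OccVec x (mapSub ts σ) →
                 Σ Var λ y → OccVec y ts × Occ x (σ y)
    occ-substᵛ (t ∷ ts) σ x (hd o) with occ-subst t σ x o
    ... | y , oy , ox = y , hd oy , ox
    occ-substᵛ (t ∷ ts) σ x (tl o) with occ-substᵛ ts σ x o
    ... | y , oy , ox = y , tl oy , ox

  occ-ren : ∀ (θ : Var → Var) (t : Term S) x → Occ x (ren θ t) → Σ Var λ y → Occ y t × x ≡ θ y
  occ-ren θ t x o with occ-subst t (λ y → var (θ y)) x o
  ... | y , oy , here = y , oy , refl

  renamed-instance : ∀ (θ : Var → Var) (t : Term S) τ σ → (∀ x → Occ x t → τ (θ x) ≡ σ x) →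
                     ren θ t ⟨ τ ⟩ ≡ t ⟨ σ ⟩
  renamed-instance θ t τ σ h = trans (subst-comp t (λ x → var (θ x)) τ) (subst-cong t h)

  mutual
    subAt-subst : ∀ (t : Term S) p w σ → subAt t p ≡ just w → subAt (t ⟨ σ ⟩) p ≡ just (w ⟨ σ ⟩)
    subAt-subst t          []      w σ refl = refl
    subAt-subst (var x)    (i ∷ p) w σ ()
    subAt-subst (fun f ts) (i ∷ p) w σ e = subAt-substᵛ ts i p w σ e

    subAt-substᵛ : ∀ {n} (ts : Vec (Term S) n) i p w σ → subAtVec ts i p ≡ just w →
                   subAtVec (mapSub ts σ) i p ≡ just (w ⟨ σ ⟩)
    subAt-substᵛ []       i       p w σ ()
    subAt-substᵛ (t ∷ ts) zero    p w σ e = subAt-subst t p w σ e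
    subAt-substᵛ (t ∷ ts) (suc i) p w σ e = subAt-substᵛ ts i p w σ e

  mutual
    replace-subst : ∀ (t : Term S) p w v σ → subAt t p ≡ just w →
                    replace t p v ⟨ σ ⟩ ≡ replace (t ⟨ σ ⟩) p (v ⟨ σ ⟩)
    replace-subst t          []      w v σ e = refl
    replace-subst (var x)    (i ∷ p) w v σ ()
    replace-subst (fun f ts) (i ∷ p) w v σ e = cong (fun f) (replace-substᵛ ts i p w v σ e)

    replace-substᵛ : ∀ {n} (ts : Vec (Term S) n) i p w v σ → subAtVec ts i p ≡ just w →
                     mapSub (replaceVec ts i p v) σ ≡ replaceVec (mapSub ts σ) i p (v ⟨ σ ⟩)
    replace-substᵛ []       i       p w v σ ()
    replace-substᵛ (t ∷ ts) zero    p w v σ e = cong (_∷ mapSub ts σ) (replace-subst t p w v σ e)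
    replace-substᵛ (t ∷ ts) (suc i) p w v σ e = cong ((t ⟨ σ ⟩) ∷_) (replace-substᵛ ts i p w v σ e)

  mutual
    subAt-++ : ∀ (t : Term S) q r v → subAt t q ≡ just v → subAt t (q ++ r) ≡ subAt v r
    subAt-++ t          []      r v refl = refl
    subAt-++ (var x)    (i ∷ q) r v ()
    subAt-++ (fun f ts) (i ∷ q) r v e = subAt-++ᵛ ts i q r v e

    subAt-++ᵛ : ∀ {n} (ts : Vec (Term S) n) i q r v → subAtVec ts i q ≡ just v →
                subAtVec ts i (q ++ r) ≡ subAt v r
    subAt-++ᵛ []       i       q r v ()
    subAt-++ᵛ (t ∷ ts) zero    q r v e = subAt-++ t q r v e
    subAt-++ᵛ (t ∷ ts) (suc i) q r v e = subAt-++ᵛ ts i q r v e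

  mutual
    subAt-replace : ∀ (c : Term S) q r v u → subAt c q ≡ just u → subAt (replace c q v) (q ++ r) ≡ subAt v r
    subAt-replace c          []      r v u e = refl
    subAt-replace (var x)    (i ∷ q) r v u ()
    subAt-replace (fun f ts) (i ∷ q) r v u e = subAt-replaceᵛ ts i q r v u e

    subAt-replaceᵛ : ∀ {n} (ts : Vec (Term S) n) i q r v u → subAtVec ts i q ≡ just u →
                     subAtVec (replaceVec ts i q v) i (q ++ r) ≡ subAt v r
    subAt-replaceᵛ []       i       q r v u ()
    subAt-replaceᵛ (t ∷ ts) zero    q r v u e = subAt-replace t q r v u e
    subAt-replaceᵛ (t ∷ ts) (suc i) q r v u e = subAt-replaceᵛ ts i q r v u e

  mutual
    replace-replace : ∀ (c : Term S) q r v w u → subAt c q ≡ just u →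
                      replace (replace c q v) (q ++ r) w ≡ replace c q (replace v r w)
    replace-replace c          []      r v w u e = refl
    replace-replace (var x)    (i ∷ q) r v w u ()
    replace-replace (fun f ts) (i ∷ q) r v w u e = cong (fun f) (replace-replaceᵛ ts i q r v w u e)

    replace-replaceᵛ : ∀ {n} (ts : Vec (Term S) n) i q r v w u → subAtVec ts i q ≡ just u →
                       replaceVec (replaceVec ts i q v) i (q ++ r) w ≡ replaceVec ts i q (replace v r w)
    replace-replaceᵛ []       i       q r v w u ()
    replace-replaceᵛ (t ∷ ts) zero    q r v w u e = cong (_∷ ts) (replace-replace t q r v w u e)
    replace-replaceᵛ (t ∷ ts) (suc i) q r v w u e = cong (t ∷_) (replace-replaceᵛ ts i q r v w u e)

  mutual
    replace-self : ∀ (s : Term S) q v → subAt s q ≡ just v → replace s q v ≡ s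
    replace-self s          []      v refl = refl
    replace-self (var x)    (i ∷ q) v ()
    replace-self (fun f ts) (i ∷ q) v e = cong (fun f) (replace-selfᵛ ts i q v e)

    replace-selfᵛ : ∀ {n} (ts : Vec (Term S) n) i q v → subAtVec ts i q ≡ just v → replaceVec ts i q v ≡ ts
    replace-selfᵛ []       i       q v ()
    replace-selfᵛ (t ∷ ts) zero    q v e = cong (_∷ ts) (replace-self t q v e)
    replace-selfᵛ (t ∷ ts) (suc i) q v e = cong (t ∷_) (replace-selfᵛ ts i q v e)

  mutual
    subAt-occ : ∀ (t : Term S) r w x → subAt t r ≡ just w → Occ x w → Occ x t
    subAt-occ t          []      w x refl o = o
    subAt-occ (var y)    (i ∷ r) w x ()
    subAt-occ (fun f ts) (i ∷ r) w x e o = inside (subAt-occᵛ ts i r w x e o)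

    subAt-occᵛ : ∀ {n} (ts : Vec (Term S) n) i r w x → subAtVec ts i r ≡ just w → Occ x w → OccVec x ts
    subAt-occᵛ []       i       r w x ()
    subAt-occᵛ (t ∷ ts) zero    r w x e o = hd (subAt-occ t r w x e o)
    subAt-occᵛ (t ∷ ts) (suc i) r w x e o = tl (subAt-occᵛ ts i r w x e o)

  fpos? : (l : Term S) (r : Pos) → Dec (FPos l r)
  fpos? l r with subAt l r
  ... | nothing         = no λ ()
  ... | just (var x)    = no λ ()
  ... | just (fun f ts) = yes (f , ts , refl)

-- The proof is the Martelli–Montanari algorithm; it terminates
-- because a fixed solution τ₀ makes the total size of the τ₀-instances of
-- the equations' left-hand sides decrease at every step.
module Unification {S : Signature} where
  open TermAlgebra {S}

  Equation : Set
  Equation = Term S × Term S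

  Unifies : Subst {S} → List Equation → Set
  Unifies σ E = All (λ e → proj₁ e ⟨ σ ⟩ ≡ proj₂ e ⟨ σ ⟩) E

  MGU : List Equation → Set
  MGU E = Σ (Subst {S}) λ μ → Unifies μ E × (∀ τ → Unifies τ E → ∀ x → τ x ≡ μ x ⟨ τ ⟩)

  mutual
    size : Term S → ℕ
    size (var x)    = 1
    size (fun f ts) = suc (sizeᵛ ts)

    sizeᵛ : ∀ {n} → Vec (Term S) n → ℕ
    sizeᵛ []       = 0
    sizeᵛ (t ∷ ts) = size t + sizeᵛ ts

  size-pos : ∀ (t : Term S) → 1 ≤ size t
  size-pos (var x)    = s≤s z≤n
  size-pos (fun f ts) = s≤s z≤n

  mutual
    occ-size : ∀ (t : Term S) x σ → Occ x t → size (σ x) ≤ size (t ⟨ σ ⟩)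
    occ-size (var x)    x σ here       = ≤-refl
    occ-size (fun f ts) x σ (inside o) = m≤n⇒m≤1+n (occ-sizeᵛ ts x σ o)

    occ-sizeᵛ : ∀ {n} (ts : Vec (Term S) n) x σ → OccVec x ts → size (σ x) ≤ sizeᵛ (mapSub ts σ)
    occ-sizeᵛ (t ∷ ts) x σ (hd o) = ≤-trans (occ-size t x σ o) (m≤m+n _ _)
    occ-sizeᵛ (t ∷ ts) x σ (tl o) = ≤-trans (occ-sizeᵛ ts x σ o) (m≤n+m _ _)

  occurs-check : ∀ x f ts (τ : Subst {S}) → τ x ≡ fun f ts ⟨ τ ⟩ → ¬ Occ x (fun f ts)
  occurs-check x f ts τ e (inside o) = <-irrefl (cong size e) (s≤s (occ-sizeᵛ ts x τ o))

  fun-injective : ∀ {f g} {as : Vec (Term S) (arity S f)} {bs : Vec (Term S) (arity S g)} →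
                  fun f as ≡ fun g bs → Σ (f ≡ g) λ { refl → as ≡ bs }
  fun-injective refl = refl , refl

  fun-args-injective : ∀ {f} {as bs : Vec (Term S) (arity S f)} → fun f as ≡ fun f bs → as ≡ bs
  fun-args-injective refl = refl

  pairs : ∀ {n} → Vec (Term S) n → Vec (Term S) n → List Equation
  pairs []       []       = []
  pairs (t ∷ ts) (u ∷ us) = (t , u) ∷ pairs ts us

  unifies-pairs : ∀ {n} σ (ts us : Vec (Term S) n) E →
                  mapSub ts σ ≡ mapSub us σ → Unifies σ E → Unifies σ (pairs ts us ++ E)
  unifies-pairs σ []       []       E e u = u
  unifies-pairs σ (t ∷ ts) (v ∷ us) E e u =
    proj₁ (vec-∷-injective e) ∷ unifies-pairs σ ts us E (proj₂ (vec-∷-injective e)) u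

  unifies-pairs⁻ : ∀ {n} σ (ts us : Vec (Term S) n) E →
                   Unifies σ (pairs ts us ++ E) → mapSub ts σ ≡ mapSub us σ × Unifies σ E
  unifies-pairs⁻ σ []       []       E u = refl , u
  unifies-pairs⁻ σ (t ∷ ts) (v ∷ us) E (e ∷ u) with unifies-pairs⁻ σ ts us E u
  ... | es , u' = cong₂ _∷_ e es , u'

  instantiate : Subst {S} → List Equation → List Equation
  instantiate ρ []            = []
  instantiate ρ ((a , b) ∷ E) = (a ⟨ ρ ⟩ , b ⟨ ρ ⟩) ∷ instantiate ρ E

  unifies-instantiate : ∀ ρ μ E → Unifies μ (instantiate ρ E) → Unifies (ρ ⨾ μ) E
  unifies-instantiate ρ μ []            []      = []
  unifies-instantiate ρ μ ((a , b) ∷ E) (e ∷ u) =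
    trans (sym (subst-comp a ρ μ)) (trans e (subst-comp b ρ μ)) ∷ unifies-instantiate ρ μ E u

  unifies-instantiate⁻ : ∀ ρ μ E → Unifies (ρ ⨾ μ) E → Unifies μ (instantiate ρ E)
  unifies-instantiate⁻ ρ μ []            []      = []
  unifies-instantiate⁻ ρ μ ((a , b) ∷ E) (e ∷ u) =
    trans (subst-comp a ρ μ) (trans e (sym (subst-comp b ρ μ))) ∷ unifies-instantiate⁻ ρ μ E u

  unifies-cong : ∀ {σ σ'} E → (∀ y → σ y ≡ σ' y) → Unifies σ E → Unifies σ' E
  unifies-cong []            h []      = []
  unifies-cong ((a , b) ∷ E) h (e ∷ u) =
    trans (subst-cong a (λ y _ → sym (h y))) (trans e (subst-cong b (λ y _ → h y))) ∷ unifies-cong E h u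

  bind : Var → Term S → Subst {S}
  bind x t y with y ≟ x
  ... | yes _ = t
  ... | no _  = var y

  bind-here : ∀ x t → bind x t x ≡ t
  bind-here x t with x ≟ x
  ... | yes _  = refl
  ... | no x≢x = ⊥-elim (x≢x refl)

  bind-elsewhere : ∀ x t y → ¬ y ≡ x → bind x t y ≡ var y
  bind-elsewhere x t y y≢x with y ≟ x
  ... | yes y≡x = ⊥-elim (y≢x y≡x)
  ... | no _    = refl

  bind-absorbed : ∀ x t (τ : Subst {S}) → τ x ≡ t ⟨ τ ⟩ → ∀ y → bind x t y ⟨ τ ⟩ ≡ τ y
  bind-absorbed x t τ e y with y ≟ x
  ... | yes refl = sym e
  ... | no _     = refl

  bind-solves : ∀ x t μ → ¬ Occ x t → bind x t x ⟨ μ ⟩ ≡ t ⟨ bind x t ⨾ μ ⟩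
  bind-solves x t μ x∉t = begin
    bind x t x ⟨ μ ⟩             ≡⟨ cong (_⟨ μ ⟩) (bind-here x t) ⟩
    t ⟨ μ ⟩                      ≡⟨ cong (_⟨ μ ⟩) (sym (subst-id t)) ⟩
    t ⟨ var ⟩ ⟨ μ ⟩              ≡⟨ cong (_⟨ μ ⟩) (subst-cong t λ y o → sym (bind-elsewhere x t y λ { refl → x∉t o })) ⟩
    t ⟨ bind x t ⟩ ⟨ μ ⟩         ≡⟨ subst-comp t (bind x t) μ ⟩
    t ⟨ bind x t ⨾ μ ⟩           ∎
    where open ≡-Reasoning

  swap-first : ∀ a b E → MGU ((a , b) ∷ E) → MGU ((b , a) ∷ E)
  swap-first a b E (μ , e ∷ u , mg) = μ , sym e ∷ u , λ { τ (e' ∷ u') → mg τ (sym e' ∷ u') }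

  measure-drop : ∀ a m n → 1 ≤ a → a + m < suc n → m < n
  measure-drop a m n 1≤a lt = ≤-trans (+-monoˡ-≤ m 1≤a) (≤-pred lt)

  module _ (τ₀ : Subst {S}) where

    measure : List Equation → ℕ
    measure []            = 0
    measure ((a , b) ∷ E) = size (a ⟨ τ₀ ⟩) + measure E

    measure-pairs : ∀ {n} (ts us : Vec (Term S) n) E →
                    measure (pairs ts us ++ E) ≡ sizeᵛ (mapSub ts τ₀) + measure E
    measure-pairs []       []       E = refl
    measure-pairs (t ∷ ts) (v ∷ us) E =
      trans (cong (size (t ⟨ τ₀ ⟩) +_) (measure-pairs ts us E)) (sym (+-assoc (size (t ⟨ τ₀ ⟩)) _ _))

    measure-instantiate : ∀ ρ E → (∀ y → ρ y ⟨ τ₀ ⟩ ≡ τ₀ y) → measure (instantiate ρ E) ≡ measure E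
    measure-instantiate ρ []            h = refl
    measure-instantiate ρ ((a , b) ∷ E) h =
      cong₂ _+_ (cong size (trans (subst-comp a ρ τ₀) (subst-cong a (λ y _ → h y)))) (measure-instantiate ρ E h)

    mutual
      solve : (n : ℕ) (E : List Equation) → Unifies τ₀ E → measure E < n → MGU E
      solve (suc n) [] u lt = var , [] , λ τ _ x → refl
      solve (suc n) ((var x , var y) ∷ E) (e ∷ u) lt with x ≟ y
      ... | yes refl with solve n E u (measure-drop (size (τ₀ x)) _ n (size-pos (τ₀ x)) lt)
      ...   | μ , uμ , mg = μ , refl ∷ uμ , λ { τ (_ ∷ uτ) → mg τ uτ }
      solve (suc n) ((var x , var y) ∷ E) (e ∷ u) lt | no x≢y =
        eliminate n x (var y) e (λ { here → x≢y refl }) E u (measure-drop (size (τ₀ x)) _ n (size-pos (τ₀ x)) lt)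
      solve (suc n) ((var x , fun f ts) ∷ E) (e ∷ u) lt =
        eliminate n x (fun f ts) e (occurs-check x f ts τ₀ e) E u
          (measure-drop (size (τ₀ x)) _ n (size-pos (τ₀ x)) lt)
      solve (suc n) ((fun f ts , var x) ∷ E) (e ∷ u) lt =
        swap-first (var x) (fun f ts) E
          (eliminate n x (fun f ts) (sym e) (occurs-check x f ts τ₀ (sym e)) E u
            (measure-drop (size (fun f ts ⟨ τ₀ ⟩)) _ n (size-pos (fun f ts ⟨ τ₀ ⟩)) lt))
      solve (suc n) ((fun f ts , fun g us) ∷ E) (e ∷ u) lt with fun-injective e
      ... | refl , args with solve n (pairs ts us ++ E) (unifies-pairs τ₀ ts us E args u)
                               (subst (_< n) (sym (measure-pairs ts us E)) (≤-pred lt))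
      ...   | μ , uμ , mg =
        μ , cong (fun f) (proj₁ (unifies-pairs⁻ μ ts us E uμ)) ∷ proj₂ (unifies-pairs⁻ μ ts us E uμ) ,
        λ { τ (eτ ∷ uτ) → mg τ (unifies-pairs τ ts us E (fun-args-injective eτ) uτ) }

      eliminate : (n : ℕ) (x : Var) (t : Term S) → τ₀ x ≡ t ⟨ τ₀ ⟩ → ¬ Occ x t →
                  (E : List Equation) → Unifies τ₀ E → measure E < n → MGU ((var x , t) ∷ E)
      eliminate n x t e x∉t E u lt
        with solve n (instantiate (bind x t) E)
               (unifies-instantiate⁻ (bind x t) τ₀ E (unifies-cong E (λ y → sym (bind-absorbed x t τ₀ e y)) u))
               (subst (_< n) (sym (measure-instantiate (bind x t) E (bind-absorbed x t τ₀ e))) lt)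
      ... | μ , uμ , mg =
        bind x t ⨾ μ ,
        bind-solves x t μ x∉t ∷ unifies-instantiate (bind x t) μ E uμ ,
        λ { τ (eτ ∷ uτ) y →
              let uτ' = unifies-instantiate⁻ (bind x t) τ E
                          (unifies-cong E (λ z → sym (bind-absorbed x t τ eτ z)) uτ)
              in sym (trans (subst-comp (bind x t y) μ τ)
                       (trans (subst-cong (bind x t y) (λ z _ → sym (mg τ uτ' z))) (bind-absorbed x t τ eτ y))) }

  mgu : (a b : Term S) (τ₀ : Subst {S}) → a ⟨ τ₀ ⟩ ≡ b ⟨ τ₀ ⟩ →
        Σ (Subst {S}) λ μ → a ⟨ μ ⟩ ≡ b ⟨ μ ⟩ × (∀ τ → a ⟨ τ ⟩ ≡ b ⟨ τ ⟩ → ∀ x → τ x ≡ μ x ⟨ τ ⟩)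
  mgu a b τ₀ e with solve τ₀ (suc (measure τ₀ ((a , b) ∷ []))) ((a , b) ∷ []) (e ∷ []) ≤-refl
  ... | μ , (eμ ∷ []) , mg = μ , eμ , λ τ eτ → mg τ (eτ ∷ [])

-- Renaming apart.  The involution exchanging the blocks [0, N) and [N, 2N)
-- of variables maps every variable below N to one at least N.
module BlockSwap (N : ℕ) where

  swap : Var → Var
  swap x with x <? N
  ... | yes _ = x + N
  ... | no _ with x <? N + N
  ...   | yes _ = x ∸ N
  ...   | no _  = x

  swap-low : ∀ x → x < N → swap x ≡ x + N
  swap-low x x<N with x <? N
  ... | yes _   = refl
  ... | no x≮N = ⊥-elim (x≮N x<N)

  swap-mid : ∀ x → ¬ x < N → x < N + N → swap x ≡ x ∸ N
  swap-mid x x≮N x<2N with x <? N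
  ... | yes x<N = ⊥-elim (x≮N x<N)
  ... | no _ with x <? N + N
  ...   | yes _    = refl
  ...   | no x≮2N = ⊥-elim (x≮2N x<2N)

  swap-high : ∀ x → ¬ x < N → ¬ x < N + N → swap x ≡ x
  swap-high x x≮N x≮2N with x <? N
  ... | yes x<N = ⊥-elim (x≮N x<N)
  ... | no _ with x <? N + N
  ...   | yes x<2N = ⊥-elim (x≮2N x<2N)
  ...   | no _     = refl

  swap-moves-low : ∀ x → x < N → N ≤ swap x
  swap-moves-low x x<N rewrite swap-low x x<N = m≤n+m N x

  swap-involutive : ∀ x → swap (swap x) ≡ x
  swap-involutive x = by-block (x <? N) (x <? N + N)
    where
      by-block : Dec (x < N) → Dec (x < N + N) → swap (swap x) ≡ x
      by-block (yes x<N) _ = begin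
        swap (swap x)   ≡⟨ cong swap (swap-low x x<N) ⟩
        swap (x + N)    ≡⟨ swap-mid (x + N) (λ lt → <⇒≱ lt (m≤n+m N x)) (+-monoˡ-< N x<N) ⟩
        x + N ∸ N       ≡⟨ m+n∸n≡m x N ⟩
        x               ∎
        where open ≡-Reasoning
      by-block (no x≮N) (yes x<2N) = begin
        swap (swap x)   ≡⟨ cong swap (swap-mid x x≮N x<2N) ⟩
        swap (x ∸ N)    ≡⟨ swap-low (x ∸ N) x-N<N ⟩
        x ∸ N + N       ≡⟨ m∸n+n≡m (≮⇒≥ x≮N) ⟩
        x               ∎
        where
          open ≡-Reasoning
          x-N<N : x ∸ N < N
          x-N<N = subst (x ∸ N <_) (m+n∸n≡m N N) (∸-monoˡ-< x<2N (≮⇒≥ x≮N))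
      by-block (no x≮N) (no x≮2N) = trans (cong swap (swap-high x x≮N x≮2N)) (swap-high x x≮N x≮2N)

module VariableBound {S : Signature} where

  mutual
    varBound : Term S → ℕ
    varBound (var x)    = suc x
    varBound (fun f ts) = varBoundᵛ ts

    varBoundᵛ : ∀ {n} → Vec (Term S) n → ℕ
    varBoundᵛ []       = 0
    varBoundᵛ (t ∷ ts) = varBound t ⊔ varBoundᵛ ts

  mutual
    occ-varBound : ∀ {x} (t : Term S) → Occ x t → x < varBound t
    occ-varBound (var x)    here       = ≤-refl
    occ-varBound (fun f ts) (inside o) = occ-varBoundᵛ ts o

    occ-varBoundᵛ : ∀ {x n} (ts : Vec (Term S) n) → OccVec x ts → x < varBoundᵛ ts
    occ-varBoundᵛ (t ∷ ts) (hd o) = ≤-trans (occ-varBound t o) (m≤m⊔n _ _)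
    occ-varBoundᵛ (t ∷ ts) (tl o) = ≤-trans (occ-varBoundᵛ ts o) (m≤n⊔m _ _)

  ruleBound : Rule S → ℕ
  ruleBound ρ = varBound (lhs ρ) ⊔ varBound (rhs ρ)

  occ-ruleBound : ∀ ρ x → OccRule x ρ → x < ruleBound ρ
  occ-ruleBound ρ x (inj₁ o) = ≤-trans (occ-varBound (lhs ρ) o) (m≤m⊔n _ _)
  occ-ruleBound ρ x (inj₂ o) = ≤-trans (occ-varBound (rhs ρ) o) (m≤n⊔m _ _)

module Diagrams {S : Signature} (R : TRS S) {L : Set} (_>_ _≥_ : L → L → Set)
                (ℓ : LabFun S L) (isL : IsLabeling R _>_ _≥_ ℓ) where
  open TermAlgebra {S}
  open IsLabeling isL

  Conversion : (L → Set) → Term S → Term S → Set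
  Conversion = Conv R _>_ _≥_ ℓ

  ELD : Term S → RPat S → Term S → RPat S → Term S → Set
  ELD = ExtLocDecr R _>_ _≥_ ℓ

  -- the diagram required of a peak t ← s → u whose steps carry labels α, β;
  -- ELD t π₁ s π₂ u unfolds to Diagram (ℓ bwd t π₁ s) (ℓ fwd s π₂ u) t u
  Diagram : L → L → Term S → Term S → Set
  Diagram α β t u = Σ (Term S) λ t' → Σ (Term S) λ t'' → Σ (Term S) λ u'' → Σ (Term S) λ u' →
    Conversion (λ γ → α > γ) t t' ×
    FwdOpt R _>_ _≥_ ℓ (λ γ → β ≥ γ) t' t'' ×
    Conversion (λ γ → α > γ ⊎ β > γ) t'' u'' ×
    BwdOpt R _>_ _≥_ ℓ (λ γ → α ≥ γ) u'' u' ×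
    Conversion (λ γ → β > γ) u' u

  relabel : ∀ {α α' β β' t t' u u'} → t ≡ t' → u ≡ u' → α ≡ α' → β ≡ β' →
            Diagram α β t u → Diagram α' β' t' u'
  relabel refl refl refl refl d = d

  conv-map : ∀ {P Q : L → Set} {a b} → (∀ {γ} → P γ → Q γ) → Conversion P a b → Conversion Q a b
  conv-map h refl-c          = refl-c
  conv-map h (fwd-c st p cv) = fwd-c st (h p) (conv-map h cv)
  conv-map h (bwd-c st p cv) = bwd-c st (h p) (conv-map h cv)

  conv-++ : ∀ {P : L → Set} {a b c} → Conversion P a b → Conversion P b c → Conversion P a c
  conv-++ refl-c          cv' = cv'
  conv-++ (fwd-c st p cv) cv' = fwd-c st p (conv-++ cv cv')
  conv-++ (bwd-c st p cv) cv' = bwd-c st p (conv-++ cv cv')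

  -- a conversion read backwards; labels are preserved by (iii)
  conv-reverse : ∀ {P : L → Set} {a b} → Conversion P a b → Conversion P b a
  conv-reverse refl-c = refl-c
  conv-reverse {P} (fwd-c {s} {π} {u} st p cv) =
    conv-++ (conv-reverse cv) (bwd-c st (subst P (symm s π u st) p) refl-c)
  conv-reverse {P} (bwd-c {s} {π} {u} st p cv) =
    conv-++ (conv-reverse cv) (fwd-c st (subst P (sym (symm u π s st)) p) refl-c)

  swap-⊎ : ∀ {A B : Set} → A ⊎ B → B ⊎ A
  swap-⊎ (inj₁ a) = inj₂ a
  swap-⊎ (inj₂ b) = inj₁ b

  diagram-mirror : ∀ {α β t u} → Diagram α β u t → Diagram β α t u
  diagram-mirror {α} {β} (u' , u'' , t'' , t' , cv₁ , step₁ , cv₂ , step₂ , cv₃) =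
    t' , t'' , u'' , u' , conv-reverse cv₃ , reverse-bwd step₂ ,
    conv-reverse (conv-map swap-⊎ cv₂) , reverse-fwd step₁ , conv-reverse cv₁
    where
      reverse-bwd : BwdOpt R _>_ _≥_ ℓ (α ≥_) t'' t' → FwdOpt R _>_ _≥_ ℓ (α ≥_) t' t''
      reverse-bwd (inj₁ e)            = inj₁ (sym e)
      reverse-bwd (inj₂ (π , st , p)) = inj₂ (π , st , subst (α ≥_) (sym (symm _ π _ st)) p)
      reverse-fwd : FwdOpt R _>_ _≥_ ℓ (β ≥_) u' u'' → BwdOpt R _>_ _≥_ ℓ (β ≥_) u'' u'
      reverse-fwd (inj₁ e)            = inj₁ (sym e)
      reverse-fwd (inj₂ (π , st , p)) = inj₂ (π , st , subst (β ≥_) (symm _ π _ st) p)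

  ELD-swap : ∀ {s t u π₁ π₂} → Step R s π₁ t → Step R s π₂ u → ELD u π₂ s π₁ t → ELD t π₁ s π₂ u
  ELD-swap {s} {t} {u} {π₁} {π₂} st₁ st₂ d =
    relabel refl refl (symm s π₁ t st₁) (sym (symm s π₂ u st₂)) (diagram-mirror d)

  DStep : Dir → Term S → RPat S → Term S → Set
  DStep fwd a π b = Step R a π b
  DStep bwd a π b = Step R b π a

  source target : Dir → Term S → Term S → Term S
  source fwd a b = a
  source bwd a b = b
  target fwd a b = b
  target bwd a b = a

  as-forward : ∀ d {a π b} → DStep d a π b → Step R (source d a b) π (target d a b)
  as-forward fwd st = st
  as-forward bwd st = st

  forward-label : ∀ d {a π b} → DStep d a π b → ℓ d a π b ≡ ℓ fwd (source d a b) π (target d a b)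
  forward-label fwd st = refl
  forward-label bwd st = sym (symm _ _ _ st)

  Closed : (L → L → Set) → Set
  Closed Rel = ∀ s π₁ t u π₂ v → Step R s π₁ t → Step R u π₂ v →
               Rel (ℓ fwd s π₁ t) (ℓ fwd u π₂ v) →
               ∀ (c : Term S) (q : Pos) → ValidPos c q → (σ : Subst {S}) →
               Rel (ℓ fwd (replace c q (s ⟨ σ ⟩)) (ctxPat q π₁ σ) (replace c q (t ⟨ σ ⟩)))
                   (ℓ fwd (replace c q (u ⟨ σ ⟩)) (ctxPat q π₂ σ) (replace c q (v ⟨ σ ⟩)))

  module Lifting (c : Term S) (q : Pos) (cq : Term S) (c|q : subAt c q ≡ just cq) (δ : Subst {S}) where

    lift : Term S → Term S
    lift a = replace c q (a ⟨ δ ⟩)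

    liftπ : RPat S → RPat S
    liftπ π = ctxPat q π δ

    lift-step : ∀ {a π b} → Step R a π b → Step R (lift a) (liftπ π) (lift b)
    lift-step {a} {⟪ p , ρ , σ ⟫} (ρ∈R , a|p , refl) =
      ρ∈R ,
      trans (subAt-replace c q p (a ⟨ δ ⟩) cq c|q)
            (trans (subAt-subst a p _ δ a|p) (cong just (subst-comp (lhs ρ) σ δ))) ,
      trans (cong (replace c q) (replace-subst a p _ (rhs ρ ⟨ σ ⟩) δ a|p))
        (trans (sym (replace-replace c q p (a ⟨ δ ⟩) (rhs ρ ⟨ σ ⟩ ⟨ δ ⟩) cq c|q))
               (cong (replace (replace c q (a ⟨ δ ⟩)) (q ++ p)) (subst-comp (rhs ρ) σ δ)))

    lifted-forward-label : ∀ d {a π b} → DStep d a π b →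
      ℓ d (lift a) (liftπ π) (lift b) ≡ ℓ fwd (lift (source d a b)) (liftπ π) (lift (target d a b))
    lifted-forward-label fwd st = refl
    lifted-forward-label bwd st = sym (symm _ _ _ (lift-step st))

    lift-rel : ∀ (Rel : L → L → Set) → Closed Rel → ∀ d₁ d₂ {a₁ π₁ b₁ a₂ π₂ b₂} →
               DStep d₁ a₁ π₁ b₁ → DStep d₂ a₂ π₂ b₂ → Rel (ℓ d₁ a₁ π₁ b₁) (ℓ d₂ a₂ π₂ b₂) →
               Rel (ℓ d₁ (lift a₁) (liftπ π₁) (lift b₁)) (ℓ d₂ (lift a₂) (liftπ π₂) (lift b₂))
    lift-rel Rel closed d₁ d₂ st₁ st₂ r =
      subst₂ Rel (sym (lifted-forward-label d₁ st₁)) (sym (lifted-forward-label d₂ st₂))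
        (closed _ _ _ _ _ _ (as-forward d₁ st₁) (as-forward d₂ st₂)
                (subst₂ Rel (forward-label d₁ st₁) (forward-label d₂ st₂) r) c q (cq , c|q) δ)

    lift-conv : ∀ {P P' : L → Set} {a b} →
                (∀ d {a π b} → DStep d a π b → P (ℓ d a π b) → P' (ℓ d (lift a) (liftπ π) (lift b))) →
                Conversion P a b → Conversion P' (lift a) (lift b)
    lift-conv h refl-c          = refl-c
    lift-conv h (fwd-c st p cv) = fwd-c (lift-step st) (h fwd st p) (lift-conv h cv)
    lift-conv h (bwd-c st p cv) = bwd-c (lift-step st) (h bwd st p) (lift-conv h cv)

    lift-ELD : ∀ {s t u π₁ π₂} → Step R s π₁ t → Step R s π₂ u → ELD t π₁ s π₂ u →
               ELD (lift t) (liftπ π₁) (lift s) (liftπ π₂) (lift u)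
    lift-ELD {s} {t} {u} {π₁} {π₂} st₁ st₂ (t' , t'' , u'' , u' , cv₁ , step₁ , cv₂ , step₂ , cv₃) =
      lift t' , lift t'' , lift u'' , lift u' ,
      lift-conv below-α cv₁ ,
      lift-fwd step₁ ,
      lift-conv (λ { d st (inj₁ p) → inj₁ (below-α d st p) ; d st (inj₂ p) → inj₂ (below-β d st p) }) cv₂ ,
      lift-bwd step₂ ,
      lift-conv below-β cv₃
      where
        below-α : ∀ d {a π b} → DStep d a π b → ℓ bwd t π₁ s > ℓ d a π b →
                  ℓ bwd (lift t) (liftπ π₁) (lift s) > ℓ d (lift a) (liftπ π) (lift b)
        below-α d st = lift-rel _>_ closed-> bwd d st₁ st
        below-β : ∀ d {a π b} → DStep d a π b → ℓ fwd s π₂ u > ℓ d a π b →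
                  ℓ fwd (lift s) (liftπ π₂) (lift u) > ℓ d (lift a) (liftπ π) (lift b)
        below-β d st = lift-rel _>_ closed-> fwd d st₂ st
        lift-fwd : FwdOpt R _>_ _≥_ ℓ (ℓ fwd s π₂ u ≥_) t' t'' →
                   FwdOpt R _>_ _≥_ ℓ (ℓ fwd (lift s) (liftπ π₂) (lift u) ≥_) (lift t') (lift t'')
        lift-fwd (inj₁ e)            = inj₁ (cong lift e)
        lift-fwd (inj₂ (π , st , p)) = inj₂ (liftπ π , lift-step st , lift-rel _≥_ closed-≥ fwd fwd st₂ st p)
        lift-bwd : BwdOpt R _>_ _≥_ ℓ (ℓ bwd t π₁ s ≥_) u'' u' →
                   BwdOpt R _>_ _≥_ ℓ (ℓ bwd (lift t) (liftπ π₁) (lift s) ≥_) (lift u'') (lift u')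
        lift-bwd (inj₁ e)            = inj₁ (cong lift e)
        lift-bwd (inj₂ (π , st , p)) = inj₂ (liftπ π , lift-step st , lift-rel _≥_ closed-≥ bwd bwd st₁ st p)

-- Function peaks are instances of critical peaks.  The peak consists of the
-- steps s →[q·r, ρ₁, σ₁] and s →[q, ρ₂, σ₂] with r a function position of l₂.
module FunctionPeak {S : Signature} (R : TRS S) {L : Set} (_>_ _≥_ : L → L → Set)
    (ℓ : LabFun S L) (isL : IsLabeling R _>_ _≥_ ℓ) (critical : CriticalPeaksELD R _>_ _≥_ ℓ)
    (s : Term S) (q r : Pos) (ρ₁ ρ₂ : Rule S) (σ₁ σ₂ : Subst {S}) (ρ₁∈R : R ρ₁) (ρ₂∈R : R ρ₂)
    (s|qr : subAt s (q ++ r) ≡ just (lhs ρ₁ ⟨ σ₁ ⟩)) (s|q : subAt s q ≡ just (lhs ρ₂ ⟨ σ₂ ⟩))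
    (f : Sym S) (ws : Vec (Term S) (arity S f)) (l₂|r : subAt (lhs ρ₂) r ≡ just (fun f ws)) where
  open TermAlgebra {S}
  open Unification {S} using (mgu)
  open VariableBound {S}
  open Diagrams R _>_ _≥_ ℓ isL
  open IsLabeling isL using (well-defined)

  N : ℕ
  N = ruleBound ρ₁ ⊔ ruleBound ρ₂

  open BlockSwap N

  ρ₁-below : ∀ x → OccRule x ρ₁ → x < N
  ρ₁-below x o = ≤-trans (occ-ruleBound ρ₁ x o) (m≤m⊔n (ruleBound ρ₁) (ruleBound ρ₂))

  ρ₂-below : ∀ x → OccRule x ρ₂ → x < N
  ρ₂-below x o = ≤-trans (occ-ruleBound ρ₂ x o) (m≤n⊔m (ruleBound ρ₁) (ruleBound ρ₂))

  variants-disjoint : ∀ x → OccRule x (renRule id ρ₁) → ¬ OccRule x (renRule swap ρ₂)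
  variants-disjoint x o₁ o₂ = <⇒≱ (below o₁) (above o₂)
    where
      below : OccRule x (renRule id ρ₁) → x < N
      below (inj₁ o) with occ-ren id (lhs ρ₁) x o
      ... | y , oy , refl = ρ₁-below y (inj₁ oy)
      below (inj₂ o) with occ-ren id (rhs ρ₁) x o
      ... | y , oy , refl = ρ₁-below y (inj₂ oy)
      above : OccRule x (renRule swap ρ₂) → N ≤ x
      above (inj₁ o) with occ-ren swap (lhs ρ₂) x o
      ... | y , oy , refl = swap-moves-low y (ρ₂-below y (inj₁ oy))
      above (inj₂ o) with occ-ren swap (rhs ρ₂) x o
      ... | y , oy , refl = swap-moves-low y (ρ₂-below y (inj₂ oy))

  overlapped : Term S
  overlapped = ren swap (fun f ws)

  l₂'|r : subAt (ren swap (lhs ρ₂)) r ≡ just overlapped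
  l₂'|r = subAt-subst (lhs ρ₂) r (fun f ws) _ l₂|r

  -- the joint substitution: σ₁ on the variant of ρ₁, σ₂ on the variant of ρ₂
  τ₀ : Subst {S}
  τ₀ y with y <? N
  ... | yes _ = σ₁ y
  ... | no _  = σ₂ (swap y)

  τ₀-on-ρ₁ : ∀ x → OccRule x ρ₁ → τ₀ (id x) ≡ σ₁ x
  τ₀-on-ρ₁ x o with x <? N
  ... | yes _   = refl
  ... | no x≮N = ⊥-elim (x≮N (ρ₁-below x o))

  τ₀-on-ρ₂ : ∀ x → OccRule x ρ₂ → τ₀ (swap x) ≡ σ₂ x
  τ₀-on-ρ₂ x o with swap x <? N
  ... | yes lt = ⊥-elim (<⇒≱ lt (swap-moves-low x (ρ₂-below x o)))
  ... | no _   = cong σ₂ (swap-involutive x)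

  -- τ₀ unifies l₁ with the overlapped subterm: both instances are s|qr
  τ₀-unifies : ren id (lhs ρ₁) ⟨ τ₀ ⟩ ≡ overlapped ⟨ τ₀ ⟩
  τ₀-unifies = begin
    ren id (lhs ρ₁) ⟨ τ₀ ⟩  ≡⟨ renamed-instance id (lhs ρ₁) τ₀ σ₁ (λ x o → τ₀-on-ρ₁ x (inj₁ o)) ⟩
    lhs ρ₁ ⟨ σ₁ ⟩           ≡⟨ just-injective (trans (sym s|qr) s|qr') ⟩
    fun f ws ⟨ σ₂ ⟩         ≡⟨ sym (renamed-instance swap (fun f ws) τ₀ σ₂ on-ws) ⟩
    overlapped ⟨ τ₀ ⟩                ∎
    where
      open ≡-Reasoning
      s|qr' : subAt s (q ++ r) ≡ just (fun f ws ⟨ σ₂ ⟩)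
      s|qr' = trans (subAt-++ s q r _ s|q) (subAt-subst (lhs ρ₂) r (fun f ws) σ₂ l₂|r)
      on-ws : ∀ x → Occ x (fun f ws) → τ₀ (swap x) ≡ σ₂ x
      on-ws x o = τ₀-on-ρ₂ x (inj₁ (subAt-occ (lhs ρ₂) r (fun f ws) x l₂|r o))

  μ₀ : Subst {S}
  μ₀ = proj₁ (mgu (ren id (lhs ρ₁)) overlapped τ₀ τ₀-unifies)

  μ₀-unifies : ren id (lhs ρ₁) ⟨ μ₀ ⟩ ≡ overlapped ⟨ μ₀ ⟩
  μ₀-unifies = proj₁ (proj₂ (mgu (ren id (lhs ρ₁)) overlapped τ₀ τ₀-unifies))

  μ₀-general : ∀ τ → ren id (lhs ρ₁) ⟨ τ ⟩ ≡ overlapped ⟨ τ ⟩ → ∀ x → τ x ≡ μ₀ x ⟨ τ ⟩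
  μ₀-general = proj₂ (proj₂ (mgu (ren id (lhs ρ₁)) overlapped τ₀ τ₀-unifies))

  μ₀-absorbed : ∀ t → t ⟨ μ₀ ⟩ ⟨ τ₀ ⟩ ≡ t ⟨ τ₀ ⟩
  μ₀-absorbed t = trans (subst-comp t μ₀ τ₀) (subst-cong t (λ y _ → sym (μ₀-general τ₀ τ₀-unifies y)))

  criticalOverlap : CriticalOverlap R
  criticalOverlap = record
    { ρ₁ = ρ₁ ; ρ₂ = ρ₂ ; ρ₁∈R = ρ₁∈R ; ρ₂∈R = ρ₂∈R
    ; θ₁ = id ; θ₁⁻ = id ; θ₂ = swap ; θ₂⁻ = swap
    ; θ₁-inv₁ = λ x → refl ; θ₁-inv₂ = λ x → refl ; θ₂-inv₁ = swap-involutive ; θ₂-inv₂ = swap-involutive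
    ; disjoint = variants-disjoint
    ; p = r ; p∈FPos = f , mapSub ws (λ y → var (swap y)) , l₂'|r
    ; w = overlapped ; w-def = l₂'|r
    ; μ = μ₀ ; unifies = μ₀-unifies ; mostGeneral = λ τ e → τ , μ₀-general τ e
    }

  source|r : subAt (cpSource criticalOverlap) r ≡ just (lhs ρ₁ ⟨ μ₀ ⟩)
  source|r = trans (subAt-subst _ r overlapped μ₀ l₂'|r)
                   (cong just (trans (sym μ₀-unifies) (subst-comp (lhs ρ₁) _ μ₀)))

  critical-step₁ : Step R (cpSource criticalOverlap) (cpπ₁ criticalOverlap) (cpLeft criticalOverlap)
  critical-step₁ = ρ₁∈R , source|r , cong (replace (cpSource criticalOverlap) r) (subst-comp (rhs ρ₁) _ μ₀)

  critical-step₂ : Step R (cpSource criticalOverlap) (cpπ₂ criticalOverlap) (cpRight criticalOverlap)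
  critical-step₂ = ρ₂∈R , cong just (subst-comp (lhs ρ₂) _ μ₀) , subst-comp (rhs ρ₂) _ μ₀

  -- lifting the critical peak by s[(·)τ₀]_q gives back the function peak
  open Lifting s q (lhs ρ₂ ⟨ σ₂ ⟩) s|q τ₀

  agrees-ρ₁ : ∀ x → OccRule x ρ₁ → μ₀ (id x) ⟨ τ₀ ⟩ ≡ σ₁ x
  agrees-ρ₁ x o = trans (sym (μ₀-general τ₀ τ₀-unifies x)) (τ₀-on-ρ₁ x o)

  agrees-ρ₂ : ∀ x → OccRule x ρ₂ → μ₀ (swap x) ⟨ τ₀ ⟩ ≡ σ₂ x
  agrees-ρ₂ x o = trans (sym (μ₀-general τ₀ τ₀-unifies (swap x))) (τ₀-on-ρ₂ x o)

  instance-ρ₁ : ∀ t → (∀ x → Occ x t → OccRule x ρ₁) → ren id t ⟨ μ₀ ⟩ ⟨ τ₀ ⟩ ≡ t ⟨ σ₁ ⟩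
  instance-ρ₁ t h = trans (μ₀-absorbed (ren id t)) (renamed-instance id t τ₀ σ₁ (λ x o → τ₀-on-ρ₁ x (h x o)))

  instance-ρ₂ : ∀ t → (∀ x → Occ x t → OccRule x ρ₂) → ren swap t ⟨ μ₀ ⟩ ⟨ τ₀ ⟩ ≡ t ⟨ σ₂ ⟩
  instance-ρ₂ t h = trans (μ₀-absorbed (ren swap t)) (renamed-instance swap t τ₀ σ₂ (λ x o → τ₀-on-ρ₂ x (h x o)))

  source-instance : cpSource criticalOverlap ⟨ τ₀ ⟩ ≡ lhs ρ₂ ⟨ σ₂ ⟩
  source-instance = instance-ρ₂ (lhs ρ₂) (λ x → inj₁)

  lift-source : lift (cpSource criticalOverlap) ≡ s
  lift-source = trans (cong (replace s q) source-instance) (replace-self s q _ s|q)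

  lift-right : lift (cpRight criticalOverlap) ≡ replace s q (rhs ρ₂ ⟨ σ₂ ⟩)
  lift-right = cong (replace s q) (instance-ρ₂ (rhs ρ₂) (λ x → inj₂))

  lift-left : lift (cpLeft criticalOverlap) ≡ replace s (q ++ r) (rhs ρ₁ ⟨ σ₁ ⟩)
  lift-left = begin
    replace s q (replace (cpSource criticalOverlap) r (ren id (rhs ρ₁) ⟨ μ₀ ⟩) ⟨ τ₀ ⟩)
      ≡⟨ cong (replace s q) (replace-subst (cpSource criticalOverlap) r _ (ren id (rhs ρ₁) ⟨ μ₀ ⟩) τ₀ source|r) ⟩
    replace s q (replace (cpSource criticalOverlap ⟨ τ₀ ⟩) r (ren id (rhs ρ₁) ⟨ μ₀ ⟩ ⟨ τ₀ ⟩))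
      ≡⟨ cong₂ (λ a b → replace s q (replace a r b)) source-instance (instance-ρ₁ (rhs ρ₁) (λ x → inj₂)) ⟩
    replace s q (replace (lhs ρ₂ ⟨ σ₂ ⟩) r (rhs ρ₁ ⟨ σ₁ ⟩))
      ≡⟨ sym (replace-replace s q r _ _ _ s|q) ⟩
    replace (replace s q (lhs ρ₂ ⟨ σ₂ ⟩)) (q ++ r) (rhs ρ₁ ⟨ σ₁ ⟩)
      ≡⟨ cong (λ a → replace a (q ++ r) (rhs ρ₁ ⟨ σ₁ ⟩)) (replace-self s q _ s|q) ⟩
    replace s (q ++ r) (rhs ρ₁ ⟨ σ₁ ⟩)
      ∎
    where open ≡-Reasoning

  -- the lifted redex patterns agree with the given ones on the rule variables
  lift-label₁ : ℓ bwd (lift (cpLeft criticalOverlap)) (liftπ (cpπ₁ criticalOverlap)) (lift (cpSource criticalOverlap))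
              ≡ ℓ bwd (replace s (q ++ r) (rhs ρ₁ ⟨ σ₁ ⟩)) ⟪ q ++ r , ρ₁ , σ₁ ⟫ s
  lift-label₁ = trans (cong₂ (λ a b → ℓ bwd a (liftπ (cpπ₁ criticalOverlap)) b) lift-left lift-source)
                      (well-defined bwd _ s (q ++ r) ρ₁ _ σ₁ agrees-ρ₁)

  lift-label₂ : ℓ fwd (lift (cpSource criticalOverlap)) (liftπ (cpπ₂ criticalOverlap)) (lift (cpRight criticalOverlap))
              ≡ ℓ fwd s ⟪ q , ρ₂ , σ₂ ⟫ (replace s q (rhs ρ₂ ⟨ σ₂ ⟩))
  lift-label₂ = begin
    ℓ fwd (lift (cpSource criticalOverlap)) (liftπ (cpπ₂ criticalOverlap)) (lift (cpRight criticalOverlap))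
      ≡⟨ cong₂ (λ a b → ℓ fwd a (liftπ (cpπ₂ criticalOverlap)) b) lift-source lift-right ⟩
    ℓ fwd s (liftπ (cpπ₂ criticalOverlap)) (replace s q (rhs ρ₂ ⟨ σ₂ ⟩))
      ≡⟨ well-defined fwd s _ (q ++ []) ρ₂ _ σ₂ agrees-ρ₂ ⟩
    ℓ fwd s ⟪ q ++ [] , ρ₂ , σ₂ ⟫ (replace s q (rhs ρ₂ ⟨ σ₂ ⟩))
      ≡⟨ cong (λ p → ℓ fwd s ⟪ p , ρ₂ , σ₂ ⟫ (replace s q (rhs ρ₂ ⟨ σ₂ ⟩))) (++-identityʳ q) ⟩
    ℓ fwd s ⟪ q , ρ₂ , σ₂ ⟫ (replace s q (rhs ρ₂ ⟨ σ₂ ⟩))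
      ∎
    where open ≡-Reasoning

  function-peak-ELD : ELD (replace s (q ++ r) (rhs ρ₁ ⟨ σ₁ ⟩)) ⟪ q ++ r , ρ₁ , σ₁ ⟫ s
                          ⟪ q , ρ₂ , σ₂ ⟫ (replace s q (rhs ρ₂ ⟨ σ₂ ⟩))
  function-peak-ELD = relabel lift-left lift-right lift-label₁ lift-label₂
                        (lift-ELD critical-step₁ critical-step₂ (critical criticalOverlap))

compare-positions : (p q : Pos) → (q ⩽ p) ⊎ ((p ⩽ q) ⊎ (p ∥ q))
compare-positions []      q       = inj₂ (inj₁ (q , refl))
compare-positions (i ∷ p) []      = inj₁ (i ∷ p , refl)
compare-positions (i ∷ p) (j ∷ q) with i ≟ j
... | no i≢j = inj₂ (inj₂ ((λ { (_ , e) → i≢j (sym (proj₁ (list-∷-injective e))) }) ,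
                           (λ { (_ , e) → i≢j (proj₁ (list-∷-injective e)) })))
... | yes refl with compare-positions p q
...   | inj₁ (r , e)                 = inj₁ (r , cong (i ∷_) e)
...   | inj₂ (inj₁ (r , e))          = inj₂ (inj₁ (r , cong (i ∷_) e))
...   | inj₂ (inj₂ (p⋬q , q⋬p)) = inj₂ (inj₂ ((λ { (r , e) → p⋬q (r , proj₂ (list-∷-injective e)) }) ,
                                            (λ { (r , e) → q⋬p (r , proj₂ (list-∷-injective e)) })))

module Peaks {S : Signature} (R : TRS S) {L : Set} (_>_ _≥_ : L → L → Set) (ℓ : LabFun S L)
             (isL : IsLabeling R _>_ _≥_ ℓ) (compatible : Compatible R _>_ _≥_ ℓ)
             (critical : CriticalPeaksELD R _>_ _≥_ ℓ) where
  open TermAlgebra {S} using (fpos?)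
  open Diagrams R _>_ _≥_ ℓ isL using (ELD)

  function-peak : ∀ s t u π₁ π₂ → Step R s π₁ t → Step R s π₂ u → (r : Pos) →
                  pos π₁ ≡ pos π₂ ++ r → FPos (lhs (rule π₂)) r → ELD t π₁ s π₂ u
  function-peak s _ _ ⟪ _ , ρ₁ , σ₁ ⟫ ⟪ q , ρ₂ , σ₂ ⟫ (ρ₁∈R , s|qr , refl) (ρ₂∈R , s|q , refl) r refl (f , ws , l₂|r) =
    FunctionPeak.function-peak-ELD R _>_ _≥_ ℓ isL critical s q r ρ₁ ρ₂ σ₁ σ₂ ρ₁∈R ρ₂∈R s|qr s|q f ws l₂|r

  nested-peak : ∀ s t u π₁ π₂ → Step R s π₁ t → Step R s π₂ u → (r : Pos) →
                pos π₁ ≡ pos π₂ ++ r → ELD t π₁ s π₂ u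
  nested-peak s t u π₁ π₂ st₁ st₂ r e with fpos? (lhs (rule π₂)) r
  ... | yes r∈FPos = function-peak s t u π₁ π₂ st₁ st₂ r e r∈FPos
  ... | no r∉FPos  = compatible s t u π₁ π₂ st₁ st₂ (inj₂ (r , e , r∉FPos))

lemma4p11 : (S : Signature) (R : TRS S) (L : Set) (_>_ _≥_ : L → L → Set)
            (ℓ : LabFun S L) →
            IsLabeling R _>_ _≥_ ℓ →
            Compatible R _>_ _≥_ ℓ →
            CriticalPeaksELD R _>_ _≥_ ℓ →
            ∀ (s t u : Term S) (π₁ π₂ : RPat S) →
            Step R s π₁ t → Step R s π₂ u →
            ExtLocDecr R _>_ _≥_ ℓ t π₁ s π₂ u
lemma4p11 S R L _>_ _≥_ ℓ isL compatible critical s t u π₁ π₂ st₁ st₂ =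
  by-positions (compare-positions (pos π₁) (pos π₂))
  where
    open Peaks R _>_ _≥_ ℓ isL compatible critical using (nested-peak)
    open Diagrams R _>_ _≥_ ℓ isL using (ELD; ELD-swap)

    by-positions : (pos π₂ ⩽ pos π₁) ⊎ ((pos π₁ ⩽ pos π₂) ⊎ (pos π₁ ∥ pos π₂)) → ELD t π₁ s π₂ u
    by-positions (inj₁ (r , e))          = nested-peak s t u π₁ π₂ st₁ st₂ r e
    by-positions (inj₂ (inj₁ (r , e)))   = ELD-swap st₁ st₂ (nested-peak s u t π₂ π₁ st₂ st₁ r e)
    by-positions (inj₂ (inj₂ parallel)) = compatible s t u π₁ π₂ st₁ st₂ (inj₁ parallel)
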